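{- For every $k\in\mathbb{N}$, $$\sum_{n\ge0}c[n,k]\frac{x^n}{[n]!}=\frac{(-\log_q(1-x))^{[k]}}{[k]!},$$ and $$\sum_{n,k\ge0}c[n,k]t^k\frac{x^n}{[n]!}=\exp_q[-t\log_q(1-x)].$$
   Context: $[m]=(1-q^m)/(1-q)$, $[m]!=[m]\cdots[1]$. The $q$-Stirling numbers of the first kind are $c[0,k]=\delta_{0,k}$ ($k\in\mathbb{Z}$) and $c[n,k]=c[n-1,k-1]+[n-1]c[n-1,k]$ for $n\ge1$. The $q$-derivative on formal power series is $D_qf(x)=\frac{f(qx)-f(x)}{qx-x}$, so $D_qx^n=[n]x^{n-1}$. The $q$-logarithm is $-\log_q(1-x)=\sum_{n\ge1}x^n/[n]$. For a formal power series $f$ with zero constant term, its symbolic powers are $f^{[0]}=1$ and, for $k\ge1$, $f^{[k]}$ is the unique formal power series with zero constant term satisfying $D_qf^{[k]}=[k]f^{[k-1]}D_qf$. For $g=\sum_{n\ge0}g_nx^n/[n]!$, the $q$-composition is $g[f]=\sum_{n\ge0}g_n f^{[n]}/[n]!$; in particular $\exp_q[f]=\sum_{n\ge0}f^{[n]}/[n]!$ where $\exp_q(x)=\sum_{n\ge 0}x^n/[n]!$. In the second identity $f=-t\log_q(1-x)$, with $t$ treated as a constant. -}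

module Defs where

open import Level using (Level)
open import Data.Nat using (ℕ; zero; suc; _∸_)
open import Algebra.Bundles using (CommutativeRing)

-- q-calculus of formal power series over a commutative ring R, with a
-- parameter q ∈ R and a family inv with inv n = [n+1]⁻¹ (the q-integers
-- are required to be invertible; see the hypothesis).
module QSeries {c ℓ : Level} (R : CommutativeRing c ℓ)
               (q : CommutativeRing.Carrier R) (inv : ℕ → CommutativeRing.Carrier R) where
  open CommutativeRing R hiding (zero)

  Σ< : ℕ → (ℕ → Carrier) → Carrier
  Σ< zero    f = 0#
  Σ< (suc n) f = Σ< n f + f n

  Π< : ℕ → (ℕ → Carrier) → Carrier
  Π< zero    f = 1#
  Π< (suc n) f = Π< n f * f n

  pow : Carrier → ℕ → Carrier
  pow x zero    = 1#
  pow x (suc n) = pow x n * x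

  qint : ℕ → Carrier
  qint m = Σ< m (pow q)

  invfact : ℕ → Carrier
  invfact n = Π< n inv

  -- q-Stirling numbers of the first kind c[n,k] (k ∈ ℕ; c[n,k] = 0 for k < 0)
  cq : ℕ → ℕ → Carrier
  cq zero    zero    = 1#
  cq zero    (suc k) = 0#
  cq (suc n) zero    = qint n * cq n zero
  cq (suc n) (suc k) = cq n k + qint n * cq n (suc k)

  -- formal power series in x: n ↦ coefficient of x^n
  Series : Set c
  Series = ℕ → Carrier

  oneS : Series
  oneS zero    = 1#
  oneS (suc n) = 0#

  _⋆_ : Series → Series → Series
  (f ⋆ g) n = Σ< (suc n) (λ i → f i * g (n ∸ i))

  scale : Carrier → Series → Series
  scale t f n = t * f n

  -- q-derivative: D_q x^n = [n] x^(n-1)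
  Dq : Series → Series
  Dq f n = qint (suc n) * f (suc n)

  -- -log_q(1 - x) = Σ_{n≥1} x^n/[n]
  negLogq : Series
  negLogq zero    = 0#
  negLogq (suc n) = inv n

  -- symbolic powers f^[k]: f^[0] = 1, and f^[k] is the series with zero
  -- constant term with D_q f^[k] = [k] f^[k-1] D_q f, i.e. its coefficient
  -- of x^(n+1) is ([k] (f^[k-1] D_q f)_n) / [n+1].
  sympow : Series → ℕ → Series
  sympow f zero          = oneS
  sympow f (suc k) zero    = 0#
  sympow f (suc k) (suc n) = inv n * (qint (suc k) * (sympow f k ⋆ Dq f) n)

  -- q-composition exp_q[f] = Σ_j f^[j]/[j]!, for f with zero constant term.
  -- Since then f^[j] has order ≥ j, the coefficient of x^m only receives
  -- contributions from j ≤ m.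
  expq : Series → Series
  expq f m = Σ< (suc m) (λ j → sympow f j m * invfact j)

{-# OPTIONS --safe #-}
-- Both sides, divided by the relevant factorials, form a family F_k of series
-- with F_0 = 1, F_{k+1}(0) = 0 and D_q F_{k+1} = F_k/(1 - x), and this system
-- has a unique solution once the q-integers are invertible.  For the Stirling
-- side the recursion is the defining recurrence of c[n,k] summed over n; for
-- the logarithmic side it is the definition of symbolic powers together with
-- D_q(-log_q(1 - x)) = 1/(1 - x).  The bivariate identity follows since
-- symbolic powers are homogeneous: (t f)^[k] = t^k f^[k].
module Submission where

open import Defs
open import Level using (Level; _⊔_)
open import Data.Nat using (ℕ; zero; suc; _∸_)
open import Data.Product using (_×_; _,_)
open import Algebra.Bundles using (CommutativeRing)
import Algebra.Properties.CommutativeSemigroup as CommutativeSemigroupProperties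
import Relation.Binary.Reasoning.Setoid as SetoidReasoning

module QStirling {c ℓ : Level} (R : CommutativeRing c ℓ)
  (q : CommutativeRing.Carrier R) (inv : ℕ → CommutativeRing.Carrier R) where

  open CommutativeRing R hiding (zero)
  open QSeries R q inv
  open CommutativeSemigroupProperties *-commutativeSemigroup
    using (x∙yz≈y∙xz; xy∙z≈y∙xz; interchange)
  open SetoidReasoning setoid

  Σ<-cong : ∀ n {f g : ℕ → Carrier} → (∀ i → f i ≈ g i) → Σ< n f ≈ Σ< n g
  Σ<-cong zero    f≈g = refl
  Σ<-cong (suc n) f≈g = +-cong (Σ<-cong n f≈g) (f≈g n)

  Σ<-distribˡ : ∀ n a (f : ℕ → Carrier) → a * Σ< n f ≈ Σ< n (λ i → a * f i)
  Σ<-distribˡ zero    a f = zeroʳ a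
  Σ<-distribˡ (suc n) a f = trans (distribˡ a _ (f n)) (+-congʳ (Σ<-distribˡ n a f))

  Σ<-distribʳ : ∀ n (f : ℕ → Carrier) a → Σ< n f * a ≈ Σ< n (λ i → f i * a)
  Σ<-distribʳ zero    f a = zeroˡ a
  Σ<-distribʳ (suc n) f a = trans (distribʳ a _ (f n)) (+-congʳ (Σ<-distribʳ n f a))

  ⋆-cong : ∀ {f f′ g g′ : Series} → (∀ i → f i ≈ f′ i) → (∀ i → g i ≈ g′ i) →
           ∀ n → (f ⋆ g) n ≈ (f′ ⋆ g′) n
  ⋆-cong f≈f′ g≈g′ n = Σ<-cong (suc n) (λ i → *-cong (f≈f′ i) (g≈g′ (n ∸ i)))

  ⋆-scale : ∀ s t f g n → (scale s f ⋆ scale t g) n ≈ (s * t) * (f ⋆ g) n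
  ⋆-scale s t f g n = begin
    Σ< (suc n) (λ i → (s * f i) * (t * g (n ∸ i)))  ≈⟨ Σ<-cong (suc n) (λ i → interchange s _ t _) ⟩
    Σ< (suc n) (λ i → (s * t) * (f i * g (n ∸ i)))  ≈⟨ Σ<-distribˡ (suc n) (s * t) _ ⟨
    (s * t) * (f ⋆ g) n                              ∎

  Dq-scale : ∀ t f n → Dq (scale t f) n ≈ t * Dq f n
  Dq-scale t f n = x∙yz≈y∙xz (qint (suc n)) t (f (suc n))

  sympow-scale : ∀ t f j n → sympow (scale t f) j n ≈ pow t j * sympow f j n
  sympow-scale t f zero    n       = sym (*-identityˡ (oneS n))
  sympow-scale t f (suc j) zero    = sym (zeroʳ (pow t (suc j)))
  sympow-scale t f (suc j) (suc n) = begin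
    inv n * (qint (suc j) * (sympow (scale t f) j ⋆ Dq (scale t f)) n)
      ≈⟨ *-congˡ (*-congˡ (⋆-cong (sympow-scale t f j) (Dq-scale t f) n)) ⟩
    inv n * (qint (suc j) * (scale (pow t j) (sympow f j) ⋆ scale t (Dq f)) n)
      ≈⟨ *-congˡ (*-congˡ (⋆-scale (pow t j) t (sympow f j) (Dq f) n)) ⟩
    inv n * (qint (suc j) * (pow t (suc j) * (sympow f j ⋆ Dq f) n))
      ≈⟨ *-congˡ (x∙yz≈y∙xz _ _ _) ⟩
    inv n * (pow t (suc j) * (qint (suc j) * (sympow f j ⋆ Dq f) n))
      ≈⟨ x∙yz≈y∙xz _ _ _ ⟩
    pow t (suc j) * sympow f (suc j) (suc n) ∎

  record IsDividedLogqPowers (F : ℕ → Series) : Set (c ⊔ ℓ) where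
    field
      at-zero : ∀ n → F 0 n ≈ oneS n
      vanish  : ∀ k → F (suc k) 0 ≈ 0#
      Dq-suc  : ∀ k n → Dq (F (suc k)) n ≈ Σ< (suc n) (F k)

  open IsDividedLogqPowers

  stirlingSeries : ℕ → Series
  stirlingSeries k n = cq n k * invfact n

  dividedLogqPower : ℕ → Series
  dividedLogqPower k n = sympow negLogq k n * invfact k

  cq-suc-zero : ∀ n → cq (suc n) 0 ≈ 0#
  cq-suc-zero zero    = zeroˡ 1#
  cq-suc-zero (suc n) = trans (*-congˡ (cq-suc-zero n)) (zeroʳ _)

  module Invertible (qint-*-inv : ∀ n → qint (suc n) * inv n ≈ 1#) where

    qint-*-inv-cancel : ∀ n x → qint (suc n) * (inv n * x) ≈ x
    qint-*-inv-cancel n x = begin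
      qint (suc n) * (inv n * x) ≈⟨ *-assoc _ _ x ⟨
      (qint (suc n) * inv n) * x ≈⟨ *-congʳ (qint-*-inv n) ⟩
      1# * x                     ≈⟨ *-identityˡ x ⟩
      x                          ∎

    inv-*-qint-cancel : ∀ n x → inv n * (qint (suc n) * x) ≈ x
    inv-*-qint-cancel n x = trans (x∙yz≈y∙xz _ _ x) (qint-*-inv-cancel n x)

    qint-*-invfact-suc : ∀ n → qint (suc n) * invfact (suc n) ≈ invfact n
    qint-*-invfact-suc n = begin
      qint (suc n) * (invfact n * inv n) ≈⟨ *-congˡ (*-comm _ (inv n)) ⟩
      qint (suc n) * (inv n * invfact n) ≈⟨ qint-*-inv-cancel n _ ⟩
      invfact n                          ∎

    IsDividedLogqPowers-unique : ∀ {F G} → IsDividedLogqPowers F → IsDividedLogqPowers G →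
                                 ∀ k n → F k n ≈ G k n
    IsDividedLogqPowers-unique isF isG zero    n    = trans (at-zero isF n) (sym (at-zero isG n))
    IsDividedLogqPowers-unique isF isG (suc k) zero = trans (vanish isF k) (sym (vanish isG k))
    IsDividedLogqPowers-unique {F} {G} isF isG (suc k) (suc n) = begin
      F (suc k) (suc n)         ≈⟨ inv-*-qint-cancel n _ ⟨
      inv n * Dq (F (suc k)) n  ≈⟨ *-congˡ (Dq-suc isF k n) ⟩
      inv n * Σ< (suc n) (F k)  ≈⟨ *-congˡ (Σ<-cong (suc n) (IsDividedLogqPowers-unique isF isG k)) ⟩
      inv n * Σ< (suc n) (G k)  ≈⟨ *-congˡ (Dq-suc isG k n) ⟨
      inv n * Dq (G (suc k)) n  ≈⟨ inv-*-qint-cancel n _ ⟩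
      G (suc k) (suc n)         ∎

    stirlingSeries-suc : ∀ k n → qint (suc n) * stirlingSeries (suc k) (suc n)
                                 ≈ stirlingSeries k n + qint n * stirlingSeries (suc k) n
    stirlingSeries-suc k n = begin
      qint (suc n) * ((cq n k + qint n * cq n (suc k)) * invfact (suc n))
        ≈⟨ x∙yz≈y∙xz _ _ _ ⟩
      (cq n k + qint n * cq n (suc k)) * (qint (suc n) * invfact (suc n))
        ≈⟨ *-congˡ (qint-*-invfact-suc n) ⟩
      (cq n k + qint n * cq n (suc k)) * invfact n
        ≈⟨ distribʳ (invfact n) _ _ ⟩
      cq n k * invfact n + (qint n * cq n (suc k)) * invfact n
        ≈⟨ +-congˡ (*-assoc _ _ _) ⟩
      stirlingSeries k n + qint n * stirlingSeries (suc k) n ∎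

    qint-*-stirlingSeries-suc : ∀ k n → qint n * stirlingSeries (suc k) n ≈ Σ< n (stirlingSeries k)
    qint-*-stirlingSeries-suc k zero    = zeroˡ _
    qint-*-stirlingSeries-suc k (suc n) = begin
      qint (suc n) * stirlingSeries (suc k) (suc n)
        ≈⟨ stirlingSeries-suc k n ⟩
      stirlingSeries k n + qint n * stirlingSeries (suc k) n
        ≈⟨ +-congˡ (qint-*-stirlingSeries-suc k n) ⟩
      stirlingSeries k n + Σ< n (stirlingSeries k)
        ≈⟨ +-comm _ _ ⟩
      Σ< (suc n) (stirlingSeries k) ∎

    stirlingSeries-isDividedLogqPowers : IsDividedLogqPowers stirlingSeries
    stirlingSeries-isDividedLogqPowers = record
      { at-zero = λ { zero → *-identityʳ 1# ; (suc n) → trans (*-congʳ (cq-suc-zero n)) (zeroˡ _) }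
      ; vanish  = λ k → zeroˡ 1#
      ; Dq-suc  = λ k n → qint-*-stirlingSeries-suc k (suc n)
      }

    Dq-sympow-suc : ∀ f k n → Dq (sympow f (suc k)) n ≈ qint (suc k) * (sympow f k ⋆ Dq f) n
    Dq-sympow-suc f k n = qint-*-inv-cancel n _

    ⋆-Dq-negLogq : ∀ g n → (g ⋆ Dq negLogq) n ≈ Σ< (suc n) g
    ⋆-Dq-negLogq g n =
      Σ<-cong (suc n) (λ i → trans (*-congˡ (qint-*-inv (n ∸ i))) (*-identityʳ (g i)))

    dividedLogqPower-isDividedLogqPowers : IsDividedLogqPowers dividedLogqPower
    dividedLogqPower-isDividedLogqPowers = record
      { at-zero = λ n → *-identityʳ (oneS n)
      ; vanish  = λ k → zeroˡ _
      ; Dq-suc  = Dq-suc′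
      }
      where
      Dq-suc′ : ∀ k n → Dq (dividedLogqPower (suc k)) n ≈ Σ< (suc n) (dividedLogqPower k)
      Dq-suc′ k n = begin
        qint (suc n) * (sympow negLogq (suc k) (suc n) * invfact (suc k))
          ≈⟨ *-assoc _ _ _ ⟨
        Dq (sympow negLogq (suc k)) n * invfact (suc k)
          ≈⟨ *-congʳ (Dq-sympow-suc negLogq k n) ⟩
        (qint (suc k) * (sympow negLogq k ⋆ Dq negLogq) n) * invfact (suc k)
          ≈⟨ xy∙z≈y∙xz _ _ _ ⟩
        (sympow negLogq k ⋆ Dq negLogq) n * (qint (suc k) * invfact (suc k))
          ≈⟨ *-cong (⋆-Dq-negLogq (sympow negLogq k) n) (qint-*-invfact-suc k) ⟩
        Σ< (suc n) (sympow negLogq k) * invfact k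
          ≈⟨ Σ<-distribʳ (suc n) _ (invfact k) ⟩
        Σ< (suc n) (dividedLogqPower k) ∎

    stirlingSeries≈dividedLogqPower : ∀ k n → stirlingSeries k n ≈ dividedLogqPower k n
    stirlingSeries≈dividedLogqPower =
      IsDividedLogqPowers-unique stirlingSeries-isDividedLogqPowers
                                 dividedLogqPower-isDividedLogqPowers

    stirling-bivariate≈expq : ∀ t n → Σ< (suc n) (λ k → cq n k * pow t k) * invfact n
                                       ≈ expq (scale t negLogq) n
    stirling-bivariate≈expq t n =
      trans (Σ<-distribʳ (suc n) _ (invfact n)) (Σ<-cong (suc n) term)
      where
      term : ∀ k → (cq n k * pow t k) * invfact n ≈ sympow (scale t negLogq) k n * invfact k
      term k = begin
        (cq n k * pow t k) * invfact n             ≈⟨ xy∙z≈y∙xz _ _ _ ⟩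
        pow t k * stirlingSeries k n               ≈⟨ *-congˡ (stirlingSeries≈dividedLogqPower k n) ⟩
        pow t k * dividedLogqPower k n             ≈⟨ *-assoc _ _ _ ⟨
        (pow t k * sympow negLogq k n) * invfact k ≈⟨ *-congʳ (sympow-scale t negLogq k n) ⟨
        sympow (scale t negLogq) k n * invfact k   ∎

theorem4p4 : {c ℓ : Level} (R : CommutativeRing c ℓ) →
    let open CommutativeRing R in
    (q : Carrier) (inv : ℕ → Carrier) →
    let open QSeries R q inv in
    (∀ n → qint (suc n) * inv n ≈ 1#) →
    (∀ k n → cq n k * invfact n ≈ sympow negLogq k n * invfact k)
    × (∀ t n → Σ< (suc n) (λ k → cq n k * pow t k) * invfact n
                 ≈ expq (scale t negLogq) n)
theorem4p4 R q inv qint-*-inv =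
  stirlingSeries≈dividedLogqPower , stirling-bivariate≈expq
  where open QStirling.Invertible R q inv qint-*-inv
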